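{- Let $p\ge q\ge1$ be integers, $n=p+q$, $N\in\mathbb Z_{>0}$, and $\gamma\in\Gamma_G(N)\setminus K$. Then $\|\gamma\|^2\ge 4N^2+n$.
   Context: $G=\mathrm{SU}(p,q)=\{g\in\mathrm{SL}_n(\mathbb C):g^*I_{p,q}g=I_{p,q}\}$ with $I_{p,q}=\mathrm{diag}(I_p,-I_q)$, $K=\mathrm S(\mathrm U(p)\times\mathrm U(q))=G\cap\mathrm U(n)$, and $\Gamma_G(N)=G\cap\big(I_n+M_n(N\mathbb Z[i])\big)$. For a complex matrix $g$, $\|g\|=(\mathrm{tr}(g^*g))^{1/2}$. -}

module Defs where

open import Data.Nat as ℕ using (ℕ; zero; suc)
open import Data.Integer as ℤ using (ℤ; +_; -_)
open import Data.Integer.Divisibility using (_∣_)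
open import Data.Fin using (Fin; toℕ; punchIn) renaming (zero to fzero; suc to fsuc)
open import Relation.Binary.PropositionalEquality using (_≡_)
open import Relation.Nullary using (¬_)
open import Data.Bool using (if_then_else_)
open import Data.Product using (_×_)

record ℤ[i] : Set where
  constructor gi
  field
    re : ℤ
    im : ℤ
open ℤ[i] public

0ᵍ 1ᵍ : ℤ[i]
0ᵍ = gi (+ 0) (+ 0)
1ᵍ = gi (+ 1) (+ 0)

infixl 6 _+ᵍ_ _-ᵍ_
infixl 7 _*ᵍ_
_+ᵍ_ : ℤ[i] → ℤ[i] → ℤ[i]
(gi a b) +ᵍ (gi c d) = gi (a ℤ.+ c) (b ℤ.+ d)

-ᵍ_ : ℤ[i] → ℤ[i]
-ᵍ (gi a b) = gi (- a) (- b)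

_-ᵍ_ : ℤ[i] → ℤ[i] → ℤ[i]
x -ᵍ y = x +ᵍ (-ᵍ y)

_*ᵍ_ : ℤ[i] → ℤ[i] → ℤ[i]
(gi a b) *ᵍ (gi c d) = gi (a ℤ.* c ℤ.- b ℤ.* d) (a ℤ.* d ℤ.+ b ℤ.* c)

conjᵍ : ℤ[i] → ℤ[i]
conjᵍ (gi a b) = gi a (- b)

absSq : ℤ[i] → ℤ
absSq (gi a b) = a ℤ.* a ℤ.+ b ℤ.* b

sumᵍ : ∀ {n} → (Fin n → ℤ[i]) → ℤ[i]
sumᵍ {zero} f = 0ᵍ
sumᵍ {suc n} f = f fzero +ᵍ sumᵍ (λ k → f (fsuc k))

sumℤ : ∀ {n} → (Fin n → ℤ) → ℤ
sumℤ {zero} f = + 0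
sumℤ {suc n} f = f fzero ℤ.+ sumℤ (λ k → f (fsuc k))

Mat : ℕ → Set
Mat n = Fin n → Fin n → ℤ[i]

_·_ : ∀ {n} → Mat n → Mat n → Mat n
(A · B) i j = sumᵍ (λ k → A i k *ᵍ B k j)

_* : ∀ {n} → Mat n → Mat n
(A *) i j = conjᵍ (A j i)

δ : ∀ {n} → Fin n → Fin n → ℤ[i]
δ fzero fzero = 1ᵍ
δ fzero (fsuc j) = 0ᵍ
δ (fsuc i) fzero = 0ᵍ
δ (fsuc i) (fsuc j) = δ i j

Id : ∀ {n} → Mat n
Id = δ

Ipq : (p q : ℕ) → Mat (p ℕ.+ q)
Ipq p q i j = if toℕ i ℕ.<ᵇ p then δ i j else -ᵍ (δ i j)

det : ∀ {n} → Mat n → ℤ[i]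
det {zero} A = 1ᵍ
det {suc n} A = sumᵍ (λ j → sign (toℕ j) (A fzero j *ᵍ det (λ r c → A (fsuc r) (punchIn j c))))
  where
  sign : ℕ → ℤ[i] → ℤ[i]
  sign zero x = x
  sign (suc k) x = -ᵍ (sign k x)

-- squared Frobenius norm ‖g‖² = tr(g* g) = Σ |g_ij|²
normSq : ∀ {n} → Mat n → ℤ
normSq A = sumℤ (λ i → sumℤ (λ j → absSq (A i j)))

InSU : (p q : ℕ) → Mat (p ℕ.+ q) → Set
InSU p q g = (∀ i j → (((g *) · Ipq p q) · g) i j ≡ Ipq p q i j) × (det g ≡ 1ᵍ)

CongId : ∀ {n} → ℕ → Mat n → Set
CongId N g = ∀ i j → ((+ N) ∣ re (g i j -ᵍ δ i j)) × ((+ N) ∣ im (g i j -ᵍ δ i j))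

InΓ : (p q N : ℕ) → Mat (p ℕ.+ q) → Set
InΓ p q N g = InSU p q g × CongId N g

Unitary : ∀ {n} → Mat n → Set
Unitary g = ∀ i j → ((g *) · g) i j ≡ δ i j

InK : (p q : ℕ) → Mat (p ℕ.+ q) → Set
InK p q g = InSU p q g × Unitary g

-- Write γ = (A B ; C D) in p + q block form.  The diagonal entries of γ* I_{p,q} γ = I_{p,q}
-- say that every column of γ has squared norm 1 + 2 × (its part in the off-diagonal block),
-- so ‖γ‖² = n + 2‖B‖² + 2‖C‖².  The entries of B and C lie in N ℤ[i], hence each of these
-- blocks is either zero or has ‖·‖² ≥ N².  If C = 0 then A*A = I, which over ℤ[i] forces A
-- to be a permuted diagonal matrix of units, and then B*A = D*C = 0 gives B = 0; symmetrically
-- B = 0 forces C = 0 through D*D = I.  A block-diagonal element of SU(p,q) is unitary, so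
-- for γ ∉ K both blocks are nonzero and ‖γ‖² ≥ n + 4N².
module Submission where

open import Defs
open import Data.Nat as ℕ using (ℕ; _≤_)
open import Data.Integer as ℤ using (+_)
open import Relation.Nullary using (¬_)

import Data.Nat.Properties as ℕP
open import Algebra.Properties.CommutativeMonoid.Sum ℕP.+-0-commutativeMonoid using (sum; sum-cong-≗; ∑-comm)
open import Algebra.Properties.CommutativeSemigroup ℕP.+-commutativeSemigroup using (x∙yz≈y∙xz)
open import Algebra.Properties.Semiring.Sum ℕP.+-*-semiring using (*-distribˡ-sum)
open import Data.Bool using (true; false)
open import Data.Fin using (Fin; _↑ˡ_; _↑ʳ_; toℕ; splitAt; punchOut) renaming (zero to fzero; suc to fsuc)
import Data.Fin.Properties as FP
open import Data.Integer using (ℤ; -_; ∣_∣)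
open import Data.Integer.Divisibility using (_∣_)
import Data.Integer.Properties as ℤP
open import Data.Integer.Tactic.RingSolver using (solve; solve-∀)
open import Data.List using (_∷_; [])
open import Data.Nat using (zero; suc)
open import Data.Nat.Divisibility using (∣⇒≤) renaming (_∣_ to _∣ℕ_)
import Data.Nat.Tactic.RingSolver as ℕ-Solver
open import Data.Product using (_×_; _,_; proj₁; proj₂; ∃)
open import Data.Sum using (_⊎_; inj₁; inj₂; [_,_]′)
open import Data.Vec.Functional using (Vector; take; drop)
open import Function using (Injective; _∘_; id)
open import Relation.Binary.PropositionalEquality
open import Relation.Nullary using (Dec; yes; no; ¬?; contradiction)
open import Relation.Nullary.Decidable using (decidable-stable)
open ≡-Reasoning

-- Arithmetic of ℤ[i]
+ᵍ-identityˡ : ∀ x → 0ᵍ +ᵍ x ≡ x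
+ᵍ-identityˡ (gi a b) = cong₂ gi (ℤP.+-identityˡ a) (ℤP.+-identityˡ b)

+ᵍ-identityʳ : ∀ x → x +ᵍ 0ᵍ ≡ x
+ᵍ-identityʳ (gi a b) = cong₂ gi (ℤP.+-identityʳ a) (ℤP.+-identityʳ b)

+ᵍ-comm : ∀ x y → x +ᵍ y ≡ y +ᵍ x
+ᵍ-comm (gi a b) (gi c d) = cong₂ gi (ℤP.+-comm a c) (ℤP.+-comm b d)

+ᵍ-assoc : ∀ x y z → (x +ᵍ y) +ᵍ z ≡ x +ᵍ (y +ᵍ z)
+ᵍ-assoc (gi a b) (gi c d) (gi e f) = cong₂ gi (ℤP.+-assoc a c e) (ℤP.+-assoc b d f)

-ᵍ-inverseˡ : ∀ x → -ᵍ x +ᵍ x ≡ 0ᵍ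
-ᵍ-inverseˡ (gi a b) = cong₂ gi (ℤP.+-inverseˡ a) (ℤP.+-inverseˡ b)

-ᵍ-involutive : ∀ x → -ᵍ -ᵍ x ≡ x
-ᵍ-involutive (gi a b) = cong₂ gi (ℤP.neg-involutive a) (ℤP.neg-involutive b)

-ᵍ-distrib-+ᵍ : ∀ x y → -ᵍ (x +ᵍ y) ≡ -ᵍ x +ᵍ -ᵍ y
-ᵍ-distrib-+ᵍ (gi a b) (gi c d) = cong₂ gi (ℤP.neg-distrib-+ a c) (ℤP.neg-distrib-+ b d)

-ᵍ-flip : ∀ x y → -ᵍ (x -ᵍ y) ≡ y -ᵍ x
-ᵍ-flip x y = begin
  -ᵍ (x +ᵍ -ᵍ y)      ≡⟨ -ᵍ-distrib-+ᵍ x (-ᵍ y) ⟩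
  -ᵍ x +ᵍ -ᵍ -ᵍ y     ≡⟨ cong (-ᵍ x +ᵍ_) (-ᵍ-involutive y) ⟩
  -ᵍ x +ᵍ y           ≡⟨ +ᵍ-comm (-ᵍ x) y ⟩
  y +ᵍ -ᵍ x           ∎

*ᵍ-identityʳ : ∀ x → x *ᵍ 1ᵍ ≡ x
*ᵍ-identityʳ (gi a b) = cong₂ gi (solve (a ∷ b ∷ [])) (solve (a ∷ b ∷ []))

*ᵍ-zeroˡ : ∀ x → 0ᵍ *ᵍ x ≡ 0ᵍ
*ᵍ-zeroˡ (gi a b) = cong₂ gi (solve (a ∷ b ∷ [])) (solve (a ∷ b ∷ []))

*ᵍ-zeroʳ : ∀ x → x *ᵍ 0ᵍ ≡ 0ᵍ
*ᵍ-zeroʳ (gi a b) = cong₂ gi (solve (a ∷ b ∷ [])) (solve (a ∷ b ∷ []))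

*ᵍ-comm : ∀ x y → x *ᵍ y ≡ y *ᵍ x
*ᵍ-comm (gi a b) (gi c d) = cong₂ gi (solve (a ∷ b ∷ c ∷ d ∷ [])) (solve (a ∷ b ∷ c ∷ d ∷ []))

*ᵍ-assoc : ∀ x y z → (x *ᵍ y) *ᵍ z ≡ x *ᵍ (y *ᵍ z)
*ᵍ-assoc (gi a b) (gi c d) (gi e f) = cong₂ gi (re-law a b c d e f) (im-law a b c d e f)
  where
  re-law : ∀ a b c d e f → (a ℤ.* c ℤ.- b ℤ.* d) ℤ.* e ℤ.- (a ℤ.* d ℤ.+ b ℤ.* c) ℤ.* f
                          ≡ a ℤ.* (c ℤ.* e ℤ.- d ℤ.* f) ℤ.- b ℤ.* (c ℤ.* f ℤ.+ d ℤ.* e)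
  re-law = solve-∀
  im-law : ∀ a b c d e f → (a ℤ.* c ℤ.- b ℤ.* d) ℤ.* f ℤ.+ (a ℤ.* d ℤ.+ b ℤ.* c) ℤ.* e
                          ≡ a ℤ.* (c ℤ.* f ℤ.+ d ℤ.* e) ℤ.+ b ℤ.* (c ℤ.* e ℤ.- d ℤ.* f)
  im-law = solve-∀

*ᵍ-neg-one : ∀ x → x *ᵍ -ᵍ 1ᵍ ≡ -ᵍ x
*ᵍ-neg-one (gi a b) = cong₂ gi (solve (a ∷ b ∷ [])) (solve (a ∷ b ∷ []))

-ᵍ-distribˡ-*ᵍ : ∀ x y → -ᵍ x *ᵍ y ≡ -ᵍ (x *ᵍ y)
-ᵍ-distribˡ-*ᵍ (gi a b) (gi c d) = cong₂ gi (re-law a b c d) (im-law a b c d)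
  where
  re-law : ∀ a b c d → (- a) ℤ.* c ℤ.- (- b) ℤ.* d ≡ - (a ℤ.* c ℤ.- b ℤ.* d)
  re-law = solve-∀
  im-law : ∀ a b c d → (- a) ℤ.* d ℤ.+ (- b) ℤ.* c ≡ - (a ℤ.* d ℤ.+ b ℤ.* c)
  im-law = solve-∀

conjᵍ-involutive : ∀ x → conjᵍ (conjᵍ x) ≡ x
conjᵍ-involutive (gi a b) = cong (gi a) (ℤP.neg-involutive b)

x-0≡x : ∀ x {y} → y ≡ 0ᵍ → x -ᵍ y ≡ x
x-0≡x x refl = +ᵍ-identityʳ x

x-y≡d⇒x≡d+y : ∀ x y {d} → x -ᵍ y ≡ d → x ≡ d +ᵍ y
x-y≡d⇒x≡d+y x y refl = sym (begin
  (x +ᵍ -ᵍ y) +ᵍ y    ≡⟨ +ᵍ-assoc x (-ᵍ y) y ⟩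
  x +ᵍ (-ᵍ y +ᵍ y)    ≡⟨ cong (x +ᵍ_) (-ᵍ-inverseˡ y) ⟩
  x +ᵍ 0ᵍ             ≡⟨ +ᵍ-identityʳ x ⟩
  x                   ∎)

x-y≡-d⇒y-x≡d : ∀ x y {d} → x -ᵍ y ≡ -ᵍ d → y -ᵍ x ≡ d
x-y≡-d⇒y-x≡d x y {d} e = begin
  y -ᵍ x              ≡⟨ -ᵍ-flip x y ⟨
  -ᵍ (x -ᵍ y)         ≡⟨ cong -ᵍ_ e ⟩
  -ᵍ -ᵍ d             ≡⟨ -ᵍ-involutive d ⟩
  d                   ∎

_≟ᵍ_ : (x y : ℤ[i]) → Dec (x ≡ y)
gi a b ≟ᵍ gi c d with a ℤ.≟ c | b ℤ.≟ d
... | yes refl | yes refl = yes refl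
... | no a≢c   | _        = no (λ e → a≢c (cong re e))
... | _        | no b≢d   = no (λ e → b≢d (cong im e))

normᵍ : ℤ[i] → ℕ
normᵍ (gi a b) = ∣ a ∣ ℕ.* ∣ a ∣ ℕ.+ ∣ b ∣ ℕ.* ∣ b ∣

i*i≡+∣i∣*∣i∣ : ∀ i → i ℤ.* i ≡ + (∣ i ∣ ℕ.* ∣ i ∣)
i*i≡+∣i∣*∣i∣ (+ n) = ℤP.+◃n≡+n (n ℕ.* n)
i*i≡+∣i∣*∣i∣ ℤ.-[1+ n ] = refl

absSq≡normᵍ : ∀ z → absSq z ≡ + normᵍ z
absSq≡normᵍ (gi a b) = cong₂ ℤ._+_ (i*i≡+∣i∣*∣i∣ a) (i*i≡+∣i∣*∣i∣ b)

conjᵍ-*ᵍ-self : ∀ z → conjᵍ z *ᵍ z ≡ gi (+ normᵍ z) (+ 0)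
conjᵍ-*ᵍ-self (gi a b) = cong₂ gi (trans (re-law a b) (absSq≡normᵍ (gi a b))) (im-law a b)
  where
  re-law : ∀ a b → a ℤ.* a ℤ.- (- b) ℤ.* b ≡ a ℤ.* a ℤ.+ b ℤ.* b
  re-law = solve-∀
  im-law : ∀ a b → a ℤ.* b ℤ.+ (- b) ℤ.* a ≡ + 0
  im-law = solve-∀

∣i∣*∣i∣≡0⇒i≡0 : ∀ i → ∣ i ∣ ℕ.* ∣ i ∣ ≡ 0 → i ≡ + 0
∣i∣*∣i∣≡0⇒i≡0 (+ zero) _ = refl

normᵍ≡0⇒≡0ᵍ : ∀ z → normᵍ z ≡ 0 → z ≡ 0ᵍ
normᵍ≡0⇒≡0ᵍ (gi a b) e = cong₂ gi (∣i∣*∣i∣≡0⇒i≡0 a (ℕP.m+n≡0⇒m≡0 _ e))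
                                  (∣i∣*∣i∣≡0⇒i≡0 b (ℕP.m+n≡0⇒n≡0 (∣ a ∣ ℕ.* ∣ a ∣) e))

-- u *ᵍ conjᵍ u = normᵍ u = 1
unit-cancel : ∀ {u} w → normᵍ u ≡ 1 → conjᵍ w *ᵍ u ≡ 0ᵍ → w ≡ 0ᵍ
unit-cancel {u} w N[u]≡1 w̄u≡0 = trans (sym (conjᵍ-involutive w)) (cong conjᵍ w̄≡0)
  where
  w̄≡0 : conjᵍ w ≡ 0ᵍ
  w̄≡0 = begin
    conjᵍ w                      ≡⟨ *ᵍ-identityʳ (conjᵍ w) ⟨
    conjᵍ w *ᵍ 1ᵍ                ≡⟨ cong (λ n → conjᵍ w *ᵍ gi (+ n) (+ 0)) N[u]≡1 ⟨
    conjᵍ w *ᵍ gi (+ normᵍ u) (+ 0) ≡⟨ cong (conjᵍ w *ᵍ_) (conjᵍ-*ᵍ-self u) ⟨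
    conjᵍ w *ᵍ (conjᵍ u *ᵍ u)    ≡⟨ cong (conjᵍ w *ᵍ_) (*ᵍ-comm (conjᵍ u) u) ⟩
    conjᵍ w *ᵍ (u *ᵍ conjᵍ u)    ≡⟨ *ᵍ-assoc (conjᵍ w) u (conjᵍ u) ⟨
    (conjᵍ w *ᵍ u) *ᵍ conjᵍ u    ≡⟨ cong (_*ᵍ conjᵍ u) w̄u≡0 ⟩
    0ᵍ *ᵍ conjᵍ u                ≡⟨ *ᵍ-zeroˡ (conjᵍ u) ⟩
    0ᵍ                           ∎

_∣ᵍ_ : ℕ → ℤ[i] → Set
N ∣ᵍ z = (+ N ∣ re z) × (+ N ∣ im z)

∣⇒square≤square : ∀ {N x} → N ∣ℕ x → x ≢ 0 → N ℕ.* N ≤ x ℕ.* x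
∣⇒square≤square {x = zero}  _   x≢0 = contradiction refl x≢0
∣⇒square≤square {x = suc x} N∣x _   = ℕP.*-mono-≤ (∣⇒≤ N∣x) (∣⇒≤ N∣x)

∣ᵍ⇒square≤normᵍ : ∀ {N z} → N ∣ᵍ z → z ≢ 0ᵍ → N ℕ.* N ≤ normᵍ z
∣ᵍ⇒square≤normᵍ {z = gi a b} (N∣a , N∣b) z≢0 with ∣ a ∣ ℕ.≟ 0 | ∣ b ∣ ℕ.≟ 0
... | no ∣a∣≢0  | _         = ℕP.≤-trans (∣⇒square≤square N∣a ∣a∣≢0) (ℕP.m≤m+n _ _)
... | yes _     | no ∣b∣≢0  = ℕP.≤-trans (∣⇒square≤square N∣b ∣b∣≢0) (ℕP.m≤n+m _ _)
... | yes ∣a∣≡0 | yes ∣b∣≡0 =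
  contradiction (cong₂ gi (ℤP.∣i∣≡0⇒i≡0 ∣a∣≡0) (ℤP.∣i∣≡0⇒i≡0 ∣b∣≡0)) z≢0

sumᵍ-cong : ∀ {n} {f g : Vector ℤ[i] n} → (∀ k → f k ≡ g k) → sumᵍ f ≡ sumᵍ g
sumᵍ-cong {zero}  _   = refl
sumᵍ-cong {suc n} f≗g = cong₂ _+ᵍ_ (f≗g fzero) (sumᵍ-cong (f≗g ∘ fsuc))

sumᵍ-zero : ∀ {n} {f : Vector ℤ[i] n} → (∀ k → f k ≡ 0ᵍ) → sumᵍ f ≡ 0ᵍ
sumᵍ-zero {zero}  _   = refl
sumᵍ-zero {suc n} f≡0 = cong₂ _+ᵍ_ (f≡0 fzero) (sumᵍ-zero (f≡0 ∘ fsuc))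

sumᵍ-neg : ∀ {n} (f : Vector ℤ[i] n) → sumᵍ (λ k → -ᵍ f k) ≡ -ᵍ sumᵍ f
sumᵍ-neg {zero}  f = refl
sumᵍ-neg {suc n} f = trans (cong (-ᵍ f fzero +ᵍ_) (sumᵍ-neg (f ∘ fsuc)))
                           (sym (-ᵍ-distrib-+ᵍ (f fzero) (sumᵍ (f ∘ fsuc))))

sumᵍ-split : ∀ m {n} (f : Vector ℤ[i] (m ℕ.+ n)) → sumᵍ f ≡ sumᵍ (take m f) +ᵍ sumᵍ (drop m f)
sumᵍ-split zero    f = sym (+ᵍ-identityˡ (sumᵍ f))
sumᵍ-split (suc m) f = trans (cong (f fzero +ᵍ_) (sumᵍ-split m (f ∘ fsuc)))
                             (sym (+ᵍ-assoc (f fzero) _ _))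

sumᵍ-single : ∀ {n} {f : Vector ℤ[i] n} r → (∀ s → s ≢ r → f s ≡ 0ᵍ) → sumᵍ f ≡ f r
sumᵍ-single {suc n} {f} fzero f≡0 =
  trans (cong (f fzero +ᵍ_) (sumᵍ-zero (λ k → f≡0 (fsuc k) λ ()))) (+ᵍ-identityʳ (f fzero))
sumᵍ-single {suc n} {f} (fsuc r) f≡0 =
  trans (cong₂ _+ᵍ_ (f≡0 fzero λ ()) (sumᵍ-single r (λ s s≢r → f≡0 (fsuc s) (s≢r ∘ FP.suc-injective))))
        (+ᵍ-identityˡ (f (fsuc r)))

re-sumᵍ : ∀ {n} (f : Vector ℤ[i] n) → re (sumᵍ f) ≡ sumℤ (λ k → re (f k))
re-sumᵍ {zero}  f = refl
re-sumᵍ {suc n} f = cong (λ t → re (f fzero) ℤ.+ t) (re-sumᵍ (f ∘ fsuc))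

sumℤ-cong : ∀ {n} {f g : Fin n → ℤ} → (∀ k → f k ≡ g k) → sumℤ f ≡ sumℤ g
sumℤ-cong {zero}  _   = refl
sumℤ-cong {suc n} f≗g = cong₂ ℤ._+_ (f≗g fzero) (sumℤ-cong (f≗g ∘ fsuc))

sumℤ-+ : ∀ {n} (f : Fin n → ℕ) → sumℤ (λ k → + f k) ≡ + sum f
sumℤ-+ {zero}  f = refl
sumℤ-+ {suc n} f = cong (λ t → + f fzero ℤ.+ t) (sumℤ-+ (f ∘ fsuc))

sum-split : ∀ m {n} (f : Vector ℕ (m ℕ.+ n)) → sum f ≡ sum (take m f) ℕ.+ sum (drop m f)
sum-split zero    f = refl
sum-split (suc m) f = trans (cong (f fzero ℕ.+_) (sum-split m (f ∘ fsuc))) (sym (ℕP.+-assoc (f fzero) _ _))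

sum-suc : ∀ {n} (f : Vector ℕ n) → sum (λ k → suc (f k)) ≡ n ℕ.+ sum f
sum-suc {zero}  f = refl
sum-suc {suc n} f = cong suc (trans (cong (f fzero ℕ.+_) (sum-suc (f ∘ fsuc))) (x∙yz≈y∙xz (f fzero) n _))

≤-sum : ∀ {n} (f : Vector ℕ n) k → f k ≤ sum f
≤-sum f fzero    = ℕP.m≤m+n (f fzero) _
≤-sum f (fsuc k) = ℕP.m≤n⇒m≤o+n (f fzero) (≤-sum (f ∘ fsuc) k)

sum≡0⇒≡0 : ∀ {n} (f : Vector ℕ n) → sum f ≡ 0 → ∀ k → f k ≡ 0
sum≡0⇒≡0 f e fzero    = ℕP.m+n≡0⇒m≡0 (f fzero) e
sum≡0⇒≡0 f e (fsuc k) = sum≡0⇒≡0 (f ∘ fsuc) (ℕP.m+n≡0⇒n≡0 (f fzero) e) k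

sum≡1⇒single : ∀ {n} (f : Vector ℕ n) → sum f ≡ 1 → ∃ λ r → f r ≡ 1 × (∀ s → s ≢ r → f s ≡ 0)
sum≡1⇒single {suc n} f e with f fzero in f₀
... | zero =
  let r , fr≡1 , rest≡0 = sum≡1⇒single (f ∘ fsuc) e in
  fsuc r , fr≡1 , λ { fzero _ → f₀ ; (fsuc s) s≢r → rest≡0 s (s≢r ∘ cong fsuc) }
... | suc zero =
  fzero , f₀ , λ { fzero 0≢0 → contradiction refl 0≢0
                 ; (fsuc s) _ → sum≡0⇒≡0 (f ∘ fsuc) (ℕP.suc-injective e) s }

injective⇒surjective : ∀ {m} {f : Fin m → Fin m} → Injective _≡_ _≡_ f → ∀ s → ∃ λ k → f k ≡ s
injective⇒surjective {suc m} {f} f-injective s with FP.any? (λ k → f k FP.≟ s)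
... | yes s∈image = s∈image
... | no  s∉image = contradiction (FP.injective⇒≤ g-injective) ℕP.1+n≰n
  where
  -- f misses s, so removing s from its codomain makes it an injection Fin (1 + m) → Fin m.
  s≢f : ∀ k → s ≢ f k
  s≢f k s≡fk = s∉image (k , sym s≡fk)
  g : Fin (suc m) → Fin m
  g k = punchOut (s≢f k)
  g-injective : Injective _≡_ _≡_ g
  g-injective {k} {l} = f-injective ∘ FP.punchOut-injective (s≢f k) (s≢f l)

↑ˡ≢↑ʳ : ∀ {p} q (a : Fin p) (s : Fin q) → a ↑ˡ q ≢ p ↑ʳ s
↑ˡ≢↑ʳ q (fsuc a) s a↑≡↑s = ↑ˡ≢↑ʳ q a s (FP.suc-injective a↑≡↑s)

↑ˡ-or-↑ʳ : ∀ p {q} (j : Fin (p ℕ.+ q)) → (∃ λ a → a ↑ˡ q ≡ j) ⊎ (∃ λ s → p ↑ʳ s ≡ j)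
↑ˡ-or-↑ʳ p j with splitAt p j in split≡
... | inj₁ a = inj₁ (a , FP.splitAt⁻¹-↑ˡ split≡)
... | inj₂ s = inj₂ (s , FP.splitAt⁻¹-↑ʳ split≡)

δ-refl : ∀ {n} (k : Fin n) → δ k k ≡ 1ᵍ
δ-refl fzero    = refl
δ-refl (fsuc k) = δ-refl k

δ-≢ : ∀ {n} {k l : Fin n} → k ≢ l → δ k l ≡ 0ᵍ
δ-≢ {k = fzero}  {fzero}  k≢l = contradiction refl k≢l
δ-≢ {k = fzero}  {fsuc l} k≢l = refl
δ-≢ {k = fsuc k} {fzero}  k≢l = refl
δ-≢ {k = fsuc k} {fsuc l} k≢l = δ-≢ (k≢l ∘ cong fsuc)

δ-injective : ∀ {m n} {f : Fin m → Fin n} → Injective _≡_ _≡_ f → ∀ k l → δ (f k) (f l) ≡ δ k l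
δ-injective {f = f} f-injective k l with k FP.≟ l
... | yes refl = trans (δ-refl (f k)) (sym (δ-refl k))
... | no  k≢l  = trans (δ-≢ (k≢l ∘ f-injective)) (sym (δ-≢ k≢l))

<ᵇ-↑ˡ : ∀ {p} q (a : Fin p) → (toℕ (a ↑ˡ q) ℕ.<ᵇ p) ≡ true
<ᵇ-↑ˡ q fzero    = refl
<ᵇ-↑ˡ q (fsuc a) = <ᵇ-↑ˡ q a

<ᵇ-↑ʳ : ∀ p {q} (s : Fin q) → (toℕ (p ↑ʳ s) ℕ.<ᵇ p) ≡ false
<ᵇ-↑ʳ zero    s = refl
<ᵇ-↑ʳ (suc p) s = <ᵇ-↑ʳ p s

Ipq-↑ˡ : ∀ {p} q (a : Fin p) m → Ipq p q (a ↑ˡ q) m ≡ δ (a ↑ˡ q) m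
Ipq-↑ˡ q a m rewrite <ᵇ-↑ˡ q a = refl

Ipq-↑ʳ : ∀ p {q} (s : Fin q) m → Ipq p q (p ↑ʳ s) m ≡ -ᵍ δ (p ↑ʳ s) m
Ipq-↑ʳ p s m rewrite <ᵇ-↑ʳ p s = refl

Ipq-diagonal : ∀ p q {l m} → l ≢ m → Ipq p q l m ≡ 0ᵍ
Ipq-diagonal p q {l} l≢m with toℕ l ℕ.<ᵇ p
... | true  = δ-≢ l≢m
... | false = cong -ᵍ_ (δ-≢ l≢m)

·-diagonalʳ : ∀ {n} (M D : Mat n) → (∀ {l m} → l ≢ m → D l m ≡ 0ᵍ) → ∀ j m → (M · D) j m ≡ M j m *ᵍ D m m
·-diagonalʳ M D D-diagonal j m = sumᵍ-single m
  (λ l l≢m → trans (cong (M j l *ᵍ_) (D-diagonal l≢m)) (*ᵍ-zeroʳ (M j l)))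

-- The Hermitian inner product on ℤ[i]ᵐ
⟪_,_⟫ : ∀ {m} → Vector ℤ[i] m → Vector ℤ[i] m → ℤ[i]
⟪ u , v ⟫ = sumᵍ (λ i → conjᵍ (u i) *ᵍ v i)

‖_‖² : ∀ {m} → Vector ℤ[i] m → ℕ
‖ u ‖² = sum (λ i → normᵍ (u i))

∑‖_‖² : ∀ {k m} → (Fin k → Vector ℤ[i] m) → ℕ
∑‖ Y ‖² = sum (λ s → ‖ Y s ‖²)

⟪⟫-zeroˡ : ∀ {m} {u : Vector ℤ[i] m} v → (∀ i → u i ≡ 0ᵍ) → ⟪ u , v ⟫ ≡ 0ᵍ
⟪⟫-zeroˡ v u≡0 = sumᵍ-zero (λ i → trans (cong (λ x → conjᵍ x *ᵍ v i) (u≡0 i)) (*ᵍ-zeroˡ (v i)))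

⟪⟫-zeroʳ : ∀ {m} u {v : Vector ℤ[i] m} → (∀ i → v i ≡ 0ᵍ) → ⟪ u , v ⟫ ≡ 0ᵍ
⟪⟫-zeroʳ u v≡0 = sumᵍ-zero (λ i → trans (cong (conjᵍ (u i) *ᵍ_) (v≡0 i)) (*ᵍ-zeroʳ (conjᵍ (u i))))

⟪⟫-split : ∀ m {n} (u v : Vector ℤ[i] (m ℕ.+ n)) → ⟪ u , v ⟫ ≡ ⟪ take m u , take m v ⟫ +ᵍ ⟪ drop m u , drop m v ⟫
⟪⟫-split m u v = sumᵍ-split m (λ i → conjᵍ (u i) *ᵍ v i)

re-⟪⟫-self : ∀ {m} (u : Vector ℤ[i] m) → re ⟪ u , u ⟫ ≡ + ‖ u ‖²
re-⟪⟫-self u = begin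
  re ⟪ u , u ⟫                               ≡⟨ re-sumᵍ (λ i → conjᵍ (u i) *ᵍ u i) ⟩
  sumℤ (λ i → re (conjᵍ (u i) *ᵍ u i))      ≡⟨ sumℤ-cong (λ i → cong re (conjᵍ-*ᵍ-self (u i))) ⟩
  sumℤ (λ i → + normᵍ (u i))                ≡⟨ sumℤ-+ (λ i → normᵍ (u i)) ⟩
  + ‖ u ‖²                                   ∎

⟪⟫-gap≡1⇒‖‖²≡suc : ∀ {m r} (u : Vector ℤ[i] m) (v : Vector ℤ[i] r) →
                   ⟪ u , u ⟫ -ᵍ ⟪ v , v ⟫ ≡ 1ᵍ → ‖ u ‖² ≡ suc ‖ v ‖²
⟪⟫-gap≡1⇒‖‖²≡suc u v gap≡1 = ℤP.+-injective (begin
  + ‖ u ‖²              ≡⟨ re-⟪⟫-self u ⟨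
  re ⟪ u , u ⟫          ≡⟨ cong re (x-y≡d⇒x≡d+y ⟪ u , u ⟫ ⟪ v , v ⟫ gap≡1) ⟩
  + 1 ℤ.+ re ⟪ v , v ⟫  ≡⟨ cong (λ t → + 1 ℤ.+ t) (re-⟪⟫-self v) ⟩
  + suc ‖ v ‖²          ∎)

Orthonormal : ∀ {m} → (Fin m → Vector ℤ[i] m) → Set
Orthonormal X = ∀ k l → ⟪ X k , X l ⟫ ≡ δ k l

-- Over ℤ[i] a vector of norm 1 has a single nonzero entry, a unit, so an orthonormal
-- family of m vectors in ℤ[i]ᵐ is a permuted diagonal matrix of units.
module OrthonormalBasis {m} (X : Fin m → Vector ℤ[i] m) (orthonormal : Orthonormal X) where

  ‖X‖²≡1 : ∀ k → ‖ X k ‖² ≡ 1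
  ‖X‖²≡1 k = ℤP.+-injective (begin
    + ‖ X k ‖²       ≡⟨ re-⟪⟫-self (X k) ⟨
    re ⟪ X k , X k ⟫ ≡⟨ cong re (orthonormal k k) ⟩
    re (δ k k)       ≡⟨ cong re (δ-refl k) ⟩
    + 1              ∎)

  -- Opaque, so that conversion checking never unfolds the search for the nonzero entry.
  opaque
    support : ∀ k → ∃ λ r → normᵍ (X k r) ≡ 1 × (∀ s → s ≢ r → normᵍ (X k s) ≡ 0)
    support k = sum≡1⇒single (λ s → normᵍ (X k s)) (‖X‖²≡1 k)

  pivot : Fin m → Fin m
  pivot k = proj₁ (support k)

  pivot-unit : ∀ k → normᵍ (X k (pivot k)) ≡ 1
  pivot-unit k = proj₁ (proj₂ (support k))

  off-pivot : ∀ k s → s ≢ pivot k → X k s ≡ 0ᵍ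
  off-pivot k s s≢pivot = normᵍ≡0⇒≡0ᵍ (X k s) (proj₂ (proj₂ (support k)) s s≢pivot)

  ⟪⟫-pivot : ∀ y k → ⟪ y , X k ⟫ ≡ conjᵍ (y (pivot k)) *ᵍ X k (pivot k)
  ⟪⟫-pivot y k = sumᵍ-single (pivot k)
    (λ s s≢pivot → trans (cong (conjᵍ (y s) *ᵍ_) (off-pivot k s s≢pivot)) (*ᵍ-zeroʳ (conjᵍ (y s))))

  orthogonal-at-pivot : ∀ y k → ⟪ y , X k ⟫ ≡ 0ᵍ → y (pivot k) ≡ 0ᵍ
  orthogonal-at-pivot y k y⊥Xk = unit-cancel (y (pivot k)) (pivot-unit k) (trans (sym (⟪⟫-pivot y k)) y⊥Xk)

  pivot-injective : Injective _≡_ _≡_ pivot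
  pivot-injective {k} {l} pk≡pl with k FP.≟ l
  ... | yes k≡l = k≡l
  ... | no  k≢l = contradiction (trans (sym (pivot-unit k)) (cong normᵍ Xk[pk]≡0)) λ ()
    where
    Xk[pk]≡0 : X k (pivot k) ≡ 0ᵍ
    Xk[pk]≡0 = subst (λ s → X k s ≡ 0ᵍ) (sym pk≡pl)
                 (orthogonal-at-pivot (X k) l (trans (orthonormal k l) (δ-≢ k≢l)))

  orthogonal⇒zero : ∀ y → (∀ k → ⟪ y , X k ⟫ ≡ 0ᵍ) → ∀ s → y s ≡ 0ᵍ
  orthogonal⇒zero y y⊥X s =
    let k , pk≡s = injective⇒surjective pivot-injective s in
    subst (λ t → y t ≡ 0ᵍ) pk≡s (orthogonal-at-pivot y k (y⊥X k))

Z≡0⇒Y≡0 : ∀ {m r k} (X : Fin m → Vector ℤ[i] m) (Z : Fin m → Vector ℤ[i] r)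
          (Y : Fin k → Vector ℤ[i] m) (W : Fin k → Vector ℤ[i] r) →
          (∀ a b → ⟪ X a , X b ⟫ -ᵍ ⟪ Z a , Z b ⟫ ≡ δ a b) →
          (∀ s a → ⟪ Y s , X a ⟫ -ᵍ ⟪ W s , Z a ⟫ ≡ 0ᵍ) →
          (∀ a i → Z a i ≡ 0ᵍ) → ∀ s i → Y s i ≡ 0ᵍ
Z≡0⇒Y≡0 X Z Y W X*X-Z*Z≡I Y*X-W*Z≡0 Z≡0 s = orthogonal⇒zero (Y s) Ys⊥X
  where
  X-orthonormal : Orthonormal X
  X-orthonormal a b = trans (sym (x-0≡x ⟪ X a , X b ⟫ (⟪⟫-zeroˡ (Z b) (Z≡0 a)))) (X*X-Z*Z≡I a b)
  open OrthonormalBasis X X-orthonormal using (orthogonal⇒zero)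
  Ys⊥X : ∀ a → ⟪ Y s , X a ⟫ ≡ 0ᵍ
  Ys⊥X a = trans (sym (x-0≡x ⟪ Y s , X a ⟫ (⟪⟫-zeroʳ (W s) (Z≡0 a)))) (Y*X-W*Z≡0 s a)

normSq≡∑‖column‖² : ∀ {n} (M : Mat n) → normSq M ≡ + sum (λ j → ‖ (λ i → M i j) ‖²)
normSq≡∑‖column‖² M = begin
  normSq M                                   ≡⟨ sumℤ-cong (λ i → row i) ⟩
  sumℤ (λ i → + sum (λ j → normᵍ (M i j)))   ≡⟨ sumℤ-+ (λ i → sum (λ j → normᵍ (M i j))) ⟩
  + sum (λ i → sum (λ j → normᵍ (M i j)))    ≡⟨ cong +_ (∑-comm (λ i j → normᵍ (M i j))) ⟩
  + sum (λ j → sum (λ i → normᵍ (M i j)))    ∎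
  where
  row : ∀ i → sumℤ (λ j → absSq (M i j)) ≡ + sum (λ j → normᵍ (M i j))
  row i = trans (sumℤ-cong (λ j → absSq≡normᵍ (M i j))) (sumℤ-+ (λ j → normᵍ (M i j)))

off-diagonal-∣ᵍ : ∀ {n N} (γ : Mat n) → CongId N γ → ∀ {i j} → i ≢ j → N ∣ᵍ γ i j
off-diagonal-∣ᵍ {N = N} γ γ≡I {i} {j} i≢j = subst (N ∣ᵍ_) (x-0≡x (γ i j) (δ-≢ i≢j)) (γ≡I i j)

∣ᵍ⇒zero⊎square≤∑‖‖² : ∀ {N k m} (Y : Fin k → Vector ℤ[i] m) → (∀ s i → N ∣ᵍ Y s i) →
                      (∀ s i → Y s i ≡ 0ᵍ) ⊎ N ℕ.* N ≤ ∑‖ Y ‖²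
∣ᵍ⇒zero⊎square≤∑‖‖² Y N∣Y with FP.any? (λ s → FP.any? (λ i → ¬? (Y s i ≟ᵍ 0ᵍ)))
... | yes (s , i , Ysi≢0) = inj₂ (ℕP.≤-trans (∣ᵍ⇒square≤normᵍ (N∣Y s i) Ysi≢0)
                                 (ℕP.≤-trans (≤-sum (λ i → normᵍ (Y s i)) i) (≤-sum (λ s → ‖ Y s ‖²) s)))
... | no  ∄nonzero        = inj₁ (λ s i → decidable-stable (Y s i ≟ᵍ 0ᵍ) (λ Ysi≢0 → ∄nonzero (s , i , Ysi≢0)))

module Blocks {p q : ℕ} (γ : Mat (p ℕ.+ q)) where

  column : Fin (p ℕ.+ q) → Vector ℤ[i] (p ℕ.+ q)
  column j i = γ i j

  upper : Fin (p ℕ.+ q) → Vector ℤ[i] p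
  upper j = take p (column j)

  lower : Fin (p ℕ.+ q) → Vector ℤ[i] q
  lower j = drop p (column j)

  -- γ = (A B ; C D) with blocks of sizes p and q, each block given by its columns.
  A : Fin p → Vector ℤ[i] p
  A a = upper (a ↑ˡ q)

  B : Fin q → Vector ℤ[i] p
  B s = upper (p ↑ʳ s)

  C : Fin p → Vector ℤ[i] q
  C a = lower (a ↑ˡ q)

  D : Fin q → Vector ℤ[i] q
  D s = lower (p ↑ʳ s)

  gram≡upper+lower : ∀ j k → ((γ *) · γ) j k ≡ ⟪ upper j , upper k ⟫ +ᵍ ⟪ lower j , lower k ⟫
  gram≡upper+lower j k = ⟪⟫-split p (column j) (column k)

  form≡upper-lower : ∀ j k → (((γ *) · Ipq p q) · γ) j k ≡ ⟪ upper j , upper k ⟫ -ᵍ ⟪ lower j , lower k ⟫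
  form≡upper-lower j k = begin
    (((γ *) · Ipq p q) · γ) j k
      ≡⟨ sumᵍ-cong (λ m → cong (_*ᵍ γ m k) (·-diagonalʳ (γ *) (Ipq p q) (Ipq-diagonal p q) j m)) ⟩
    sumᵍ term
      ≡⟨ sumᵍ-split p term ⟩
    sumᵍ (take p term) +ᵍ sumᵍ (drop p term)
      ≡⟨ cong₂ _+ᵍ_ (sumᵍ-cong upper-term)
                    (trans (sumᵍ-cong lower-term) (sumᵍ-neg (λ s → conjᵍ (lower j s) *ᵍ lower k s))) ⟩
    ⟪ upper j , upper k ⟫ -ᵍ ⟪ lower j , lower k ⟫ ∎
    where
    term : Vector ℤ[i] (p ℕ.+ q)
    term m = (conjᵍ (γ m j) *ᵍ Ipq p q m m) *ᵍ γ m k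
    upper-term : ∀ a → term (a ↑ˡ q) ≡ conjᵍ (upper j a) *ᵍ upper k a
    upper-term a = begin
      term (a ↑ˡ q)
        ≡⟨ cong (λ x → (conjᵍ (upper j a) *ᵍ x) *ᵍ upper k a) (trans (Ipq-↑ˡ q a (a ↑ˡ q)) (δ-refl (a ↑ˡ q))) ⟩
      (conjᵍ (upper j a) *ᵍ 1ᵍ) *ᵍ upper k a      ≡⟨ cong (_*ᵍ upper k a) (*ᵍ-identityʳ (conjᵍ (upper j a))) ⟩
      conjᵍ (upper j a) *ᵍ upper k a              ∎
    lower-term : ∀ s → term (p ↑ʳ s) ≡ -ᵍ (conjᵍ (lower j s) *ᵍ lower k s)
    lower-term s = begin
      term (p ↑ʳ s)
        ≡⟨ cong (λ x → (conjᵍ (lower j s) *ᵍ x) *ᵍ lower k s) (trans (Ipq-↑ʳ p s (p ↑ʳ s)) (cong -ᵍ_ (δ-refl (p ↑ʳ s)))) ⟩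
      (conjᵍ (lower j s) *ᵍ -ᵍ 1ᵍ) *ᵍ lower k s  ≡⟨ cong (_*ᵍ lower k s) (*ᵍ-neg-one (conjᵍ (lower j s))) ⟩
      -ᵍ conjᵍ (lower j s) *ᵍ lower k s          ≡⟨ -ᵍ-distribˡ-*ᵍ (conjᵍ (lower j s)) (lower k s) ⟩
      -ᵍ (conjᵍ (lower j s) *ᵍ lower k s)        ∎

  module PreservingForm (preserves-form : ∀ j k → (((γ *) · Ipq p q) · γ) j k ≡ Ipq p q j k) where

    form : ∀ j k → ⟪ upper j , upper k ⟫ -ᵍ ⟪ lower j , lower k ⟫ ≡ Ipq p q j k
    form j k = trans (sym (form≡upper-lower j k)) (preserves-form j k)

    A*A-C*C≡I : ∀ a b → ⟪ A a , A b ⟫ -ᵍ ⟪ C a , C b ⟫ ≡ δ a b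
    A*A-C*C≡I a b = trans (form (a ↑ˡ q) (b ↑ˡ q))
      (trans (Ipq-↑ˡ q a _) (δ-injective (λ {a} {b} → FP.↑ˡ-injective q a b) a b))

    B*A-D*C≡0 : ∀ s a → ⟪ B s , A a ⟫ -ᵍ ⟪ D s , C a ⟫ ≡ 0ᵍ
    B*A-D*C≡0 s a = trans (form (p ↑ʳ s) (a ↑ˡ q))
      (trans (Ipq-↑ʳ p s _) (cong -ᵍ_ (δ-≢ (↑ˡ≢↑ʳ q a s ∘ sym))))

    D*D-B*B≡I : ∀ s t → ⟪ D s , D t ⟫ -ᵍ ⟪ B s , B t ⟫ ≡ δ s t
    D*D-B*B≡I s t = x-y≡-d⇒y-x≡d ⟪ B s , B t ⟫ ⟪ D s , D t ⟫ (trans (form (p ↑ʳ s) (p ↑ʳ t))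
      (trans (Ipq-↑ʳ p s _) (cong -ᵍ_ (δ-injective (λ {s} {t} → FP.↑ʳ-injective p s t) s t))))

    C*D-A*B≡0 : ∀ a s → ⟪ C a , D s ⟫ -ᵍ ⟪ A a , B s ⟫ ≡ 0ᵍ
    C*D-A*B≡0 a s = x-y≡-d⇒y-x≡d ⟪ A a , B s ⟫ ⟪ C a , D s ⟫ (trans (form (a ↑ˡ q) (p ↑ʳ s))
      (trans (Ipq-↑ˡ q a _) (δ-≢ (↑ˡ≢↑ʳ q a s))))

    C≡0⇒B≡0 : (∀ a i → C a i ≡ 0ᵍ) → ∀ s i → B s i ≡ 0ᵍ
    C≡0⇒B≡0 = Z≡0⇒Y≡0 A C B D A*A-C*C≡I B*A-D*C≡0

    B≡0⇒C≡0 : (∀ s i → B s i ≡ 0ᵍ) → ∀ a i → C a i ≡ 0ᵍ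
    B≡0⇒C≡0 = Z≡0⇒Y≡0 D B C A D*D-B*B≡I C*D-A*B≡0

    block-diagonal⇒unitary : (∀ s i → B s i ≡ 0ᵍ) → (∀ a i → C a i ≡ 0ᵍ) → Unitary γ
    block-diagonal⇒unitary B≡0 C≡0 j k with ↑ˡ-or-↑ʳ p j
    ... | inj₁ (a , refl) = begin
      ((γ *) · γ) (a ↑ˡ q) k                  ≡⟨ gram≡upper+lower (a ↑ˡ q) k ⟩
      ⟪ A a , upper k ⟫ +ᵍ ⟪ C a , lower k ⟫  ≡⟨ cong (⟪ A a , upper k ⟫ +ᵍ_) Ca⊥ ⟩
      ⟪ A a , upper k ⟫ +ᵍ 0ᵍ                 ≡⟨ cong (λ x → ⟪ A a , upper k ⟫ -ᵍ x) Ca⊥ ⟨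
      ⟪ A a , upper k ⟫ -ᵍ ⟪ C a , lower k ⟫  ≡⟨ form (a ↑ˡ q) k ⟩
      Ipq p q (a ↑ˡ q) k                      ≡⟨ Ipq-↑ˡ q a k ⟩
      δ (a ↑ˡ q) k                            ∎
      where
      Ca⊥ : ⟪ C a , lower k ⟫ ≡ 0ᵍ
      Ca⊥ = ⟪⟫-zeroˡ (lower k) (C≡0 a)
    ... | inj₂ (s , refl) = begin
      ((γ *) · γ) (p ↑ʳ s) k                  ≡⟨ gram≡upper+lower (p ↑ʳ s) k ⟩
      ⟪ B s , upper k ⟫ +ᵍ ⟪ D s , lower k ⟫  ≡⟨ +ᵍ-comm ⟪ B s , upper k ⟫ ⟪ D s , lower k ⟫ ⟩
      ⟪ D s , lower k ⟫ +ᵍ ⟪ B s , upper k ⟫  ≡⟨ cong (⟪ D s , lower k ⟫ +ᵍ_) Bs⊥ ⟩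
      ⟪ D s , lower k ⟫ +ᵍ 0ᵍ                 ≡⟨ cong (λ x → ⟪ D s , lower k ⟫ -ᵍ x) Bs⊥ ⟨
      ⟪ D s , lower k ⟫ -ᵍ ⟪ B s , upper k ⟫  ≡⟨ x-y≡-d⇒y-x≡d ⟪ B s , upper k ⟫ ⟪ D s , lower k ⟫
                                                    (trans (form (p ↑ʳ s) k) (Ipq-↑ʳ p s k)) ⟩
      δ (p ↑ʳ s) k                            ∎
      where
      Bs⊥ : ⟪ B s , upper k ⟫ ≡ 0ᵍ
      Bs⊥ = ⟪⟫-zeroˡ (upper k) (B≡0 s)

    normSq-blocks : normSq γ ≡ + ((p ℕ.+ 2 ℕ.* ∑‖ C ‖²) ℕ.+ (q ℕ.+ 2 ℕ.* ∑‖ B ‖²))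
    normSq-blocks = begin
      normSq γ
        ≡⟨ normSq≡∑‖column‖² γ ⟩
      + sum (λ j → ‖ column j ‖²)
        ≡⟨ cong +_ (sum-cong-≗ (λ j → sum-split p (λ i → normᵍ (column j i)))) ⟩
      + sum mass
        ≡⟨ cong +_ (sum-split p mass) ⟩
      + (sum (take p mass) ℕ.+ sum (drop p mass))
        ≡⟨ cong₂ (λ x y → + (x ℕ.+ y)) (excess C upper-mass) (excess B lower-mass) ⟩
      + ((p ℕ.+ 2 ℕ.* ∑‖ C ‖²) ℕ.+ (q ℕ.+ 2 ℕ.* ∑‖ B ‖²))
        ∎
      where
      mass : Vector ℕ (p ℕ.+ q)
      mass j = ‖ upper j ‖² ℕ.+ ‖ lower j ‖²
      excess : ∀ {k m} (Y : Fin k → Vector ℤ[i] m) {f : Vector ℕ k} → (∀ s → f s ≡ suc (2 ℕ.* ‖ Y s ‖²)) →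
               sum f ≡ k ℕ.+ 2 ℕ.* ∑‖ Y ‖²
      excess {k} Y f≡ = trans (sum-cong-≗ f≡)
        (trans (sum-suc (λ s → 2 ℕ.* ‖ Y s ‖²)) (cong (k ℕ.+_) (sym (*-distribˡ-sum 2 (λ s → ‖ Y s ‖²)))))
      suc-x+x : ∀ x → suc x ℕ.+ x ≡ suc (2 ℕ.* x)
      suc-x+x = ℕ-Solver.solve-∀
      x+suc-x : ∀ x → x ℕ.+ suc x ≡ suc (2 ℕ.* x)
      x+suc-x = ℕ-Solver.solve-∀
      upper-mass : ∀ a → ‖ A a ‖² ℕ.+ ‖ C a ‖² ≡ suc (2 ℕ.* ‖ C a ‖²)
      upper-mass a = trans
        (cong (ℕ._+ ‖ C a ‖²) (⟪⟫-gap≡1⇒‖‖²≡suc (A a) (C a) (trans (A*A-C*C≡I a a) (δ-refl a))))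
        (suc-x+x ‖ C a ‖²)
      lower-mass : ∀ s → ‖ B s ‖² ℕ.+ ‖ D s ‖² ≡ suc (2 ℕ.* ‖ B s ‖²)
      lower-mass s = trans
        (cong (‖ B s ‖² ℕ.+_) (⟪⟫-gap≡1⇒‖‖²≡suc (D s) (B s) (trans (D*D-B*B≡I s s) (δ-refl s))))
        (x+suc-x ‖ B s ‖²)

lemma9p2 : (p q N : ℕ) → 1 ≤ q → q ≤ p → 1 ≤ N →
    (γ : Mat (p ℕ.+ q)) → InΓ p q N γ → ¬ InK p q γ →
    (+ (4 ℕ.* N ℕ.* N ℕ.+ (p ℕ.+ q))) ℤ.≤ normSq γ
-- The bound holds without the hypotheses q ≥ 1, p ≥ q and N ≥ 1.
lemma9p2 p q N _ _ _ γ ((preserves-form , det≡1) , γ≡I) γ∉K =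
  subst (+ (4 ℕ.* N ℕ.* N ℕ.+ (p ℕ.+ q)) ℤ.≤_) (sym normSq-blocks)
    (ℤ.+≤+ (arithmetic N²≤∑‖C‖² N²≤∑‖B‖²))
  where
  open Blocks {p} {q} γ
  open PreservingForm preserves-form

  block-diagonal⇒∈K : (∀ s i → B s i ≡ 0ᵍ) → (∀ a i → C a i ≡ 0ᵍ) → InK p q γ
  block-diagonal⇒∈K B≡0 C≡0 = (preserves-form , det≡1) , block-diagonal⇒unitary B≡0 C≡0

  N²≤∑‖C‖² : N ℕ.* N ≤ ∑‖ C ‖²
  N²≤∑‖C‖² = [ (λ C≡0 → contradiction (block-diagonal⇒∈K (C≡0⇒B≡0 C≡0) C≡0) γ∉K) , id ]′
    (∣ᵍ⇒zero⊎square≤∑‖‖² C (λ a i → off-diagonal-∣ᵍ γ γ≡I (↑ˡ≢↑ʳ q a i ∘ sym)))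

  N²≤∑‖B‖² : N ℕ.* N ≤ ∑‖ B ‖²
  N²≤∑‖B‖² = [ (λ B≡0 → contradiction (block-diagonal⇒∈K B≡0 (B≡0⇒C≡0 B≡0)) γ∉K) , id ]′
    (∣ᵍ⇒zero⊎square≤∑‖‖² B (λ s i → off-diagonal-∣ᵍ γ γ≡I (↑ˡ≢↑ʳ q i s)))

  arithmetic : ∀ {c b} → N ℕ.* N ≤ c → N ℕ.* N ≤ b →
               4 ℕ.* N ℕ.* N ℕ.+ (p ℕ.+ q) ≤ (p ℕ.+ 2 ℕ.* c) ℕ.+ (q ℕ.+ 2 ℕ.* b)
  arithmetic N²≤c N²≤b = ℕP.≤-trans (ℕP.≤-reflexive (regroup N p q))
    (ℕP.+-mono-≤ (ℕP.+-monoʳ-≤ p (ℕP.*-monoʳ-≤ 2 N²≤c)) (ℕP.+-monoʳ-≤ q (ℕP.*-monoʳ-≤ 2 N²≤b)))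
    where
    regroup : ∀ N p q → 4 ℕ.* N ℕ.* N ℕ.+ (p ℕ.+ q) ≡ (p ℕ.+ 2 ℕ.* (N ℕ.* N)) ℕ.+ (q ℕ.+ 2 ℕ.* (N ℕ.* N))
    regroup = ℕ-Solver.solve-∀
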